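{- Let $n>1$ be even and $m\ge 3$. Then $\chi_{ld}(P_m[\overline{K_n}])\le 3$ if $m$ is odd, and $\chi_{ld}(P_m[\overline{K_n}])\le 4$ if $m$ is even.
   Context: For a graph $G=(V,E)$ of order $N$ and a bijection $f\colon V\to\{1,\dots,N\}$, the weight of a vertex $u$ is $w(u)=\sum_{x\in N(u)}f(x)$, where $N(u)$ is the open neighborhood of $u$. The bijection $f$ is a local distance antimagic labeling if $w(u)\neq w(v)$ for every edge $uv$. $\chi_{ld}(G)$ is the minimum number of distinct weights over all local distance antimagic labelings of $G$. $P_m$ is the path on $m$ vertices; $\overline{K_n}$ is the edgeless graph on $n$ vertices. The lexicographic product $G[H]$ has vertex set $V(G)\times V(H)$, with $(g,h)$ adjacent to $(g',h')$ iff $gg'\in E(G)$, or $g=g'$ and $hh'\in E(H)$. -}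

module Defs where

open import Data.Nat using (ℕ; zero; suc; _+_; _*_; _≡ᵇ_)
open import Data.Bool using (Bool; true; false; _∨_; _∧_)
open import Data.Fin using (Fin; toℕ; remQuot)
open import Data.Fin.Permutation using (Permutation′; _⟨$⟩ʳ_)
open import Data.List using (List; map; allFin)
open import Data.Nat.ListAction using (sum)
open import Data.Vec using (Vec)
open import Data.Vec.Membership.Propositional using (_∈_)
open import Data.Product using (Σ; _×_; _,_; ∃)
open import Relation.Binary.PropositionalEquality using (_≡_; _≢_)

record Graph : Set where
  field
    order : ℕ
    adj   : Fin order → Fin order → Bool
open Graph public

Path : ℕ → Graph
order (Path m) = m
adj (Path m) i j = (suc (toℕ i) ≡ᵇ toℕ j) ∨ (suc (toℕ j) ≡ᵇ toℕ i)

Empty : ℕ → Graph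
order (Empty n) = n
adj (Empty n) _ _ = false

-- Lexicographic product G[H]; vertex (g,h) is encoded in Fin (|G| * |H|) via remQuot.
Lex : Graph → Graph → Graph
order (Lex G H) = order G * order H
adj (Lex G H) u v with remQuot (order H) u | remQuot (order H) v
... | (g , h) | (g' , h') = adj G g g' ∨ ((toℕ g ≡ᵇ toℕ g') ∧ adj H h h')

-- Labeling induced by a permutation: f(x) = 1 + π(x), a bijection V → {1,…,N}.
label : (G : Graph) → Permutation′ (order G) → Fin (order G) → ℕ
label G π x = suc (toℕ (π ⟨$⟩ʳ x))

weight : (G : Graph) → Permutation′ (order G) → Fin (order G) → ℕ
weight G π u = sum (map (λ x → if' (adj G u x) (label G π x)) (allFin (order G)))
  where
  if' : Bool → ℕ → ℕ
  if' true  k = k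
  if' false _ = 0

IsLDA : (G : Graph) → Permutation′ (order G) → Set
IsLDA G π = ∀ u v → adj G u v ≡ true → weight G π u ≢ weight G π v

-- χ_ld(G) ≤ k : some local distance antimagic labeling uses at most k distinct weights
-- (all weights lie in a list of k values).
χld≤ : Graph → ℕ → Set
χld≤ G k = Σ (Permutation′ (order G)) λ π →
  IsLDA G π × Σ (Vec ℕ k) λ ws → ∀ u → weight G π u ∈ ws

Even : ℕ → Set
Even n = ∃ λ k → n ≡ k + k

Odd : ℕ → Set
Odd n = ∃ λ k → n ≡ suc (k + k)

-- Write n = t + t and view a vertex of P_m[K̄_n] as a pair (j, h) of a layer j < m and a
-- position h < n; its weight is the sum of the labels in the layers j - 1 and j + 1.
-- Let σ(j) be the rank of layer j when the odd layers are listed first and the even ones after,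
-- both in increasing order, and τ(j) its rank when both parity classes are listed decreasingly.  Label (j, h) by 1 + n σ(j) + h for
-- h < t and by 1 + n τ(j) + h for h ≥ t.  Pairing the positions i and n - 1 - i, the labels of
-- layer j add up to t (1 + n (1 + σ(j) + τ(j))), which only depends on the parity of j: it is
-- L = t (1 + n ⌊m/2⌋) on odd layers and H = t (1 + n (2⌊m/2⌋ + ⌈m/2⌉)) on even ones, and
-- 2L < H.  Vertices of even layers thus weigh L or 2L and vertices of odd layers H or 2H, so
-- adjacent vertices, whose layers have different parities, get different weights.  When m is
-- odd every odd layer has two neighbouring layers, and H no longer occurs as a weight.
module Submission where

open import Defs
open import Data.Nat using (ℕ; _<_; _≤_)
open import Data.Product using (_×_)

open import Data.Bool using (true; false; if_then_else_; _∨_; T)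
open import Data.Bool.Properties using (∨-identityʳ; ∧-zeroʳ)
open import Data.Fin
  using (Fin; zero; suc; toℕ; combine; remQuot; join; splitAt; opposite; _↑ˡ_; _↑ʳ_)
open import Data.Fin.Properties
  using ( remQuot-combine; combine-remQuot; toℕ-combine; +↔⊎; toℕ-cast; toℕ-↑ˡ; toℕ-↑ʳ
        ; splitAt-↑ˡ; splitAt-↑ʳ; opposite-prop; toℕ<n)
open import Data.Fin.Permutation
  using (Permutation′; _⟨$⟩ʳ_; _⟨$⟩ˡ_; permutation; inverseˡ; inverseʳ; cast-id; reverse)
import Data.Fin.Permutation as Perm
open import Data.List using (map; allFin; tabulate)
open import Data.List.Properties using (map-tabulate)
open import Data.Nat
  using (zero; suc; _+_; _*_; _≡ᵇ_; _<ᵇ_; pred; s≤s; z≤n; ⌊_/2⌋; ⌈_/2⌉; parity; >-nonZero)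
open import Data.Nat.ListAction using () renaming (sum to listSum)
open import Data.Nat.Properties
  using ( +-*-semiring; +-assoc; +-identityʳ; *-distribˡ-+; *-monoʳ-<; +-monoʳ-<; +-mono-≤
        ; m+[n∸m]≡n; m≤m*n; m≤m+n; ≤-refl; ≤-trans; <⇒≤; <-≤-trans; ≤-<-trans; <⇒≢; >⇒≢
        ; <⇒<ᵇ; ≡ᵇ⇒≡; m≤n⇒m<n∨m≡n; ⌊n/2⌋+⌈n/2⌉≡n; ⌈n/2⌉-mono; module ≤-Reasoning)
open import Data.Nat.Tactic.RingSolver using (solve-∀)
open import Data.Parity using (Parity; 0ℙ; 1ℙ; _⁻¹)
import Data.Parity as ℙ
open import Data.Parity.Properties using (suc-homo-⁻¹; ⁻¹-selfInverse; +-homo-+; p+p≡0ℙ)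
open import Data.Product using (Σ-syntax; _,_; proj₁; proj₂; uncurry)
open import Data.Sum using (_⊎_; inj₁; inj₂; [_,_]′; swap; map₁)
import Data.Sum as Sum
open import Data.Sum.Function.Propositional using (_⊎-↔_)
open import Data.Unit using (tt)
open import Data.Vec using (_∷_; [])
open import Data.Vec.Membership.Propositional using (_∈_)
open import Data.Vec.Relation.Unary.Any using (here; there)
open import Function using (_∘_; id; const; _↔_; mk↔ₛ′)
open import Function.Properties.Inverse using (↔-trans; ↔-sym)
open import Relation.Binary.PropositionalEquality

open import Algebra.Properties.Semiring.Sum +-*-semiring

sum-tabulate : ∀ {N} (f : Fin N → ℕ) → listSum (tabulate f) ≡ ∑[ i < N ] f i
sum-tabulate {zero}  f = refl
sum-tabulate {suc N} f = cong (f zero +_) (sum-tabulate (f ∘ suc))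

sum-map-allFin : ∀ {N} (f : Fin N → ℕ) → listSum (map f (allFin N)) ≡ ∑[ i < N ] f i
sum-map-allFin f = trans (cong listSum (map-tabulate id f)) (sum-tabulate f)

∑-↑ : ∀ a {b} (f : Fin (a + b) → ℕ) →
      ∑[ i < a + b ] f i ≡ ∑[ i < a ] f (i ↑ˡ b) + ∑[ j < b ] f (a ↑ʳ j)
∑-↑ zero        f = refl
∑-↑ (suc a) {b} f = trans (cong (f zero +_) (∑-↑ a (f ∘ suc)))
  (sym (+-assoc (f zero) (∑[ i < a ] f (suc (i ↑ˡ b))) (∑[ j < b ] f (suc a ↑ʳ j))))

∑-combine : ∀ m {n} (f : Fin (m * n) → ℕ) →
            ∑[ x < m * n ] f x ≡ ∑[ g < m ] ∑[ h < n ] f (combine g h)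
∑-combine zero        f = refl
∑-combine (suc m) {n} f =
  trans (∑-↑ n f) (cong (∑[ h < n ] f (h ↑ˡ m * n) +_) (∑-combine m (f ∘ (n ↑ʳ_))))

∑-const : ∀ n c → ∑[ i < n ] c ≡ n * c
∑-const zero    c = refl
∑-const (suc n) c = cong (c +_) (∑-const n c)

∑-if : ∀ {n} b (f : Fin n → ℕ) →
       ∑[ i < n ] (if b then f i else 0) ≡ (if b then ∑[ i < n ] f i else 0)
∑-if {n} false f = sum-replicate-zero n
∑-if     true  f = refl

weight-∑ : ∀ G π u → weight G π u ≡ ∑[ x < order G ] (if adj G u x then label G π x else 0)
weight-∑ G π u =
  trans (proj₂ summand) (trans (sum-map-allFin (proj₁ summand)) (sum-cong-≗ summand-if))
  where
  -- The summand of weight is local to Defs; this pair gives it a name we can case-split under.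
  summand : Σ[ F ∈ (Fin (order G) → ℕ) ] weight G π u ≡ listSum (map F (allFin (order G)))
  summand = _ , refl
  summand-if : ∀ x → proj₁ summand x ≡ (if adj G u x then label G π x else 0)
  summand-if x with adj G u x
  ... | true  = refl
  ... | false = refl

layer : ∀ {m} n → Fin (m * n) → Fin m
layer {m} n u = proj₁ (remQuot {m} n u)

layer-combine : ∀ {m n} (g : Fin m) (h : Fin n) → layer n (combine g h) ≡ g
layer-combine g h = cong proj₁ (remQuot-combine g h)

adj-Lex-Empty : ∀ G n u v → adj (Lex G (Empty n)) u v ≡ adj G (layer n u) (layer n v)
adj-Lex-Empty G n u v =
  trans (cong (adj G (layer n u) (layer n v) ∨_) (∧-zeroʳ _)) (∨-identityʳ _)

layerSum : ∀ G n → Permutation′ (order G * n) → Fin (order G) → ℕ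
layerSum G n π g = ∑[ h < n ] label (Lex G (Empty n)) π (combine g h)

weight-Lex-Empty : ∀ G n π u → weight (Lex G (Empty n)) π u ≡
                   ∑[ g < order G ] (if adj G (layer n u) g then layerSum G n π g else 0)
weight-Lex-Empty G n π u = begin
    weight GK π u
  ≡⟨ weight-∑ GK π u ⟩
    ∑[ x < order G * n ] (if adj GK u x then label GK π x else 0)
  ≡⟨ ∑-combine (order G) _ ⟩
    ∑[ g < order G ] ∑[ h < n ] (if adj GK u (combine g h) then label GK π (combine g h) else 0)
  ≡⟨ sum-cong-≗ layer-term ⟩
    ∑[ g < order G ] (if adj G (layer n u) g then layerSum G n π g else 0) ∎
  where
  open ≡-Reasoning
  GK : Graph
  GK = Lex G (Empty n)
  adj-layer : ∀ g h → adj GK u (combine g h) ≡ adj G (layer n u) g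
  adj-layer g h =
    trans (adj-Lex-Empty G n u (combine g h)) (cong (adj G (layer n u)) (layer-combine g h))
  layer-term : ∀ g → ∑[ h < n ] (if adj GK u (combine g h) then label GK π (combine g h) else 0) ≡
                     (if adj G (layer n u) g then layerSum G n π g else 0)
  layer-term g = trans
    (sum-cong-≗ λ h → cong (λ b → if b then label GK π (combine g h) else 0) (adj-layer g h))
    (∑-if (adj G (layer n u) g) (label GK π ∘ combine g))

neighbourSum : ℕ → (ℕ → ℕ) → ℕ → ℕ
neighbourSum m T j = (if 0 <ᵇ j then T (pred j) else 0) + (if suc j <ᵇ m then T (suc j) else 0)

∑-adj-Path : ∀ {m} (j : Fin m) (T : ℕ → ℕ) →
             ∑[ k < m ] (if adj (Path m) j k then T (toℕ k) else 0) ≡ neighbourSum m T (toℕ j)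
∑-adj-Path {suc zero}    zero    T = refl
∑-adj-Path {suc (suc m)} zero    T =
  trans (cong (T 1 +_) (sum-replicate-zero m)) (+-identityʳ (T 1))
∑-adj-Path {suc m}       (suc j) T = begin
    left + ∑[ k < m ] (if adj (Path m) j k then T (suc (toℕ k)) else 0)
  ≡⟨ cong (left +_) (∑-adj-Path j (T ∘ suc)) ⟩
    left + (inner + right)
  ≡⟨ +-assoc left inner right ⟨
    (left + inner) + right
  ≡⟨ cong (_+ right) (absorb-left (toℕ j)) ⟩
    T (toℕ j) + right ∎
  where
  open ≡-Reasoning
  left inner right : ℕ
  left  = if 0 ≡ᵇ toℕ j then T 0 else 0
  inner = if 0 <ᵇ toℕ j then T (suc (pred (toℕ j))) else 0
  right = if suc (toℕ j) <ᵇ m then T (suc (suc (toℕ j))) else 0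
  absorb-left : ∀ i → (if 0 ≡ᵇ i then T 0 else 0) + (if 0 <ᵇ i then T (suc (pred i)) else 0) ≡ T i
  absorb-left zero    = +-identityʳ (T 0)
  absorb-left (suc i) = refl

path-adjacent : ∀ {m} (a b : Fin m) → adj (Path m) a b ≡ true →
                suc (toℕ a) ≡ toℕ b ⊎ suc (toℕ b) ≡ toℕ a
path-adjacent a b e with suc (toℕ a) ≡ᵇ toℕ b in eq
... | true  = inj₁ (≡ᵇ⇒≡ _ _ (subst T (sym eq) tt))
... | false = inj₂ (≡ᵇ⇒≡ _ _ (subst T (sym e) tt))

fibrewise : ∀ {m n} → (Fin n → Permutation′ m) → Permutation′ (m * n)
fibrewise {m} {n} σ = permutation (along (_⟨$⟩ʳ_ ∘ σ)) (along (_⟨$⟩ˡ_ ∘ σ))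
  (along-inverse (_⟨$⟩ʳ_ ∘ σ) (_⟨$⟩ˡ_ ∘ σ) (inverseʳ ∘ σ))
  (along-inverse (_⟨$⟩ˡ_ ∘ σ) (_⟨$⟩ʳ_ ∘ σ) (inverseˡ ∘ σ))
  where
  along : (Fin n → Fin m → Fin m) → Fin (m * n) → Fin (m * n)
  along f x = uncurry (λ g h → combine (f h g) h) (remQuot n x)
  along-inverse : ∀ f f′ → (∀ h {g} → f h (f′ h g) ≡ g) → ∀ x → along f (along f′ x) ≡ x
  along-inverse f f′ inv x = begin
      along f (combine (f′ h g) h)
    ≡⟨ cong (uncurry (λ g h → combine (f h g) h)) (remQuot-combine (f′ h g) h) ⟩
      combine (f h (f′ h g)) h
    ≡⟨ cong (λ g → combine g h) (inv h) ⟩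
      combine g h
    ≡⟨ combine-remQuot {m} n x ⟩
      x ∎
    where
    open ≡-Reasoning
    g : Fin m
    g = proj₁ (remQuot {m} n x)
    h : Fin n
    h = proj₂ (remQuot {m} n x)

fibrewise-combine : ∀ {m n} (σ : Fin n → Permutation′ m) g h →
                    fibrewise σ ⟨$⟩ʳ combine g h ≡ combine (σ h ⟨$⟩ʳ g) h
fibrewise-combine σ g h =
  cong (uncurry (λ g h → combine (σ h ⟨$⟩ʳ g) h)) (remQuot-combine g h)

-- The left summand collects the odd numbers below m, the right one the even numbers.
toHalves : ∀ {m} → Fin m → Fin ⌊ m /2⌋ ⊎ Fin ⌈ m /2⌉
toHalves {suc m} zero    = inj₂ zero
toHalves {suc m} (suc j) = swap (map₁ suc (toHalves j))

fromHalves : ∀ {m} → Fin ⌊ m /2⌋ ⊎ Fin ⌈ m /2⌉ → Fin m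
fromHalves {zero}  (inj₁ ())
fromHalves {zero}  (inj₂ ())
fromHalves {suc m} (inj₁ a)       = suc (fromHalves (inj₂ a))
fromHalves {suc m} (inj₂ zero)    = zero
fromHalves {suc m} (inj₂ (suc b)) = suc (fromHalves (inj₁ b))

toHalves-fromHalves : ∀ {m} (s : Fin ⌊ m /2⌋ ⊎ Fin ⌈ m /2⌉) → toHalves (fromHalves s) ≡ s
toHalves-fromHalves {suc m} (inj₁ a)       = cong (swap ∘ map₁ suc) (toHalves-fromHalves (inj₂ a))
toHalves-fromHalves {suc m} (inj₂ zero)    = refl
toHalves-fromHalves {suc m} (inj₂ (suc b)) = cong (swap ∘ map₁ suc) (toHalves-fromHalves (inj₁ b))

fromHalves-toHalves : ∀ {m} (j : Fin m) → fromHalves (toHalves j) ≡ j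
fromHalves-toHalves {suc m} zero    = refl
fromHalves-toHalves {suc m} (suc j) =
  trans (fromHalves-suc (toHalves j)) (cong suc (fromHalves-toHalves j))
  where
  fromHalves-suc : ∀ s → fromHalves (swap (map₁ suc s)) ≡ suc (fromHalves s)
  fromHalves-suc (inj₁ _) = refl
  fromHalves-suc (inj₂ _) = refl

halves : ∀ {m} → Fin m ↔ (Fin ⌊ m /2⌋ ⊎ Fin ⌈ m /2⌉)
halves = mk↔ₛ′ toHalves fromHalves toHalves-fromHalves fromHalves-toHalves

halfParity : ∀ {a b} → Fin a ⊎ Fin b → Parity
halfParity = [ const 1ℙ , const 0ℙ ]′

parity-toHalves : ∀ {m} (j : Fin m) → parity (toℕ j) ≡ halfParity (toHalves j)
parity-toHalves {suc m} zero    = refl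
parity-toHalves {suc m} (suc j) = begin
    parity (suc (toℕ j))           ≡⟨ ⁻¹-selfInverse (suc-homo-⁻¹ (toℕ j)) ⟨
    parity (toℕ j) ⁻¹              ≡⟨ cong _⁻¹ (parity-toHalves j) ⟩
    halfParity (toHalves j) ⁻¹     ≡⟨ halfParity-suc (toHalves j) ⟩
    halfParity (toHalves (suc j))  ∎
  where
  open ≡-Reasoning
  halfParity-suc : ∀ s → halfParity s ⁻¹ ≡ halfParity (swap (map₁ suc s))
  halfParity-suc (inj₁ _) = refl
  halfParity-suc (inj₂ _) = refl

parityOrder : ∀ {m} → Permutation′ ⌊ m /2⌋ → Permutation′ ⌈ m /2⌉ → Permutation′ m
parityOrder {m} p q =
  ↔-trans halves (↔-trans (p ⊎-↔ q) (↔-trans (↔-sym +↔⊎) (cast-id (⌊n/2⌋+⌈n/2⌉≡n m))))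

toℕ-parityOrder : ∀ {m} p q (j : Fin m) → toℕ (parityOrder p q ⟨$⟩ʳ j) ≡
                  [ (λ b → toℕ (p ⟨$⟩ʳ b)) , (λ a → ⌊ m /2⌋ + toℕ (q ⟨$⟩ʳ a)) ]′ (toHalves j)
toℕ-parityOrder {m} p q j = trans (toℕ-cast _ _) (toℕ-join (toHalves j))
  where
  toℕ-join : ∀ s → toℕ (join ⌊ m /2⌋ ⌈ m /2⌉ (Sum.map (p ⟨$⟩ʳ_) (q ⟨$⟩ʳ_) s)) ≡
                   [ (λ b → toℕ (p ⟨$⟩ʳ b)) , (λ a → ⌊ m /2⌋ + toℕ (q ⟨$⟩ʳ a)) ]′ s
  toℕ-join (inj₁ b) = toℕ-↑ˡ (p ⟨$⟩ʳ b) ⌈ m /2⌉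
  toℕ-join (inj₂ a) = toℕ-↑ʳ ⌊ m /2⌋ (q ⟨$⟩ʳ a)

ascending descending : ∀ {m} → Permutation′ m
ascending  = parityOrder Perm.id Perm.id
descending = parityOrder reverse reverse

suc-toℕ+toℕ-opposite : ∀ {n} (i : Fin n) → suc (toℕ i + toℕ (opposite i)) ≡ n
suc-toℕ+toℕ-opposite i = trans (cong (suc (toℕ i) +_) (opposite-prop i)) (m+[n∸m]≡n (toℕ<n i))

rankSum : ℕ → Parity → ℕ
rankSum m 1ℙ = ⌊ m /2⌋
rankSum m 0ℙ = ⌊ m /2⌋ + ⌊ m /2⌋ + ⌈ m /2⌉

shift-suc : ∀ o a b → suc (o + a + (o + b)) ≡ o + o + suc (a + b)
shift-suc = solve-∀

rankSum-parity : ∀ {m} (j : Fin m) →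
                 suc (toℕ (ascending ⟨$⟩ʳ j) + toℕ (descending ⟨$⟩ʳ j)) ≡ rankSum m (parity (toℕ j))
rankSum-parity {m} j = begin
    suc (toℕ (ascending ⟨$⟩ʳ j) + toℕ (descending ⟨$⟩ʳ j))
  ≡⟨ cong suc (cong₂ _+_ (toℕ-parityOrder Perm.id Perm.id j) (toℕ-parityOrder reverse reverse j)) ⟩
    suc (rank (toHalves j) + reversedRank (toHalves j))
  ≡⟨ by-half (toHalves j) ⟩
    rankSum m (halfParity (toHalves j))
  ≡⟨ cong (rankSum m) (parity-toHalves j) ⟨
    rankSum m (parity (toℕ j)) ∎
  where
  open ≡-Reasoning
  O : ℕ
  O = ⌊ m /2⌋
  rank reversedRank : Fin ⌊ m /2⌋ ⊎ Fin ⌈ m /2⌉ → ℕ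
  rank         = [ toℕ , (O +_) ∘ toℕ ]′
  reversedRank = [ toℕ ∘ opposite , (O +_) ∘ toℕ ∘ opposite ]′
  by-half : ∀ s → suc (rank s + reversedRank s) ≡ rankSum m (halfParity s)
  by-half (inj₁ b) = suc-toℕ+toℕ-opposite b
  by-half (inj₂ a) = trans (shift-suc O (toℕ a) (toℕ (opposite a)))
                           (cong (O + O +_) (suc-toℕ+toℕ-opposite a))

complementary-sum : ∀ {t} a d i o → suc (i + o) ≡ t →
                    suc ((t + t) * a + i) + suc ((t + t) * d + (t + o)) ≡ suc ((t + t) * suc (a + d))
complementary-sum a d i o refl = identity a d i o
  where
  identity : ∀ a d i o → let t = suc (i + o) in
             suc ((t + t) * a + i) + suc ((t + t) * d + (t + o)) ≡ suc ((t + t) * suc (a + d))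
  identity = solve-∀

layerOrder : ∀ {m} t → Fin (t + t) → Permutation′ m
layerOrder t h = [ const ascending , const descending ]′ (splitAt t h)

layerOrder-↑ˡ : ∀ {m t} (i : Fin t) → layerOrder {m} t (i ↑ˡ t) ≡ ascending
layerOrder-↑ˡ {t = t} i = cong [ const ascending , const descending ]′ (splitAt-↑ˡ t i t)

layerOrder-↑ʳ : ∀ {m t} (i : Fin t) → layerOrder {m} t (t ↑ʳ i) ≡ descending
layerOrder-↑ʳ {t = t} i = cong [ const ascending , const descending ]′ (splitAt-↑ʳ t t i)

labelling : ∀ m t → Permutation′ (m * (t + t))
labelling m t = fibrewise (layerOrder {m} t)

module _ (m t : ℕ) where

  private
    n : ℕ
    n = t + t
    G : Graph
    G = Lex (Path m) (Empty n)
    π : Permutation′ (m * n)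
    π = labelling m t

  layerValue : Parity → ℕ
  layerValue p = t * suc (n * rankSum m p)

  label-labelling : ∀ j h → label G π (combine j h) ≡ suc (n * toℕ (layerOrder {m} t h ⟨$⟩ʳ j) + toℕ h)
  label-labelling j h =
    cong suc (trans (cong toℕ (fibrewise-combine (layerOrder {m} t) j h)) (toℕ-combine _ h))

  complementary-labels : ∀ j (i : Fin t) →
    label G π (combine j (i ↑ˡ t)) + label G π (combine j (t ↑ʳ opposite i)) ≡
    suc (n * rankSum m (parity (toℕ j)))
  complementary-labels j i = begin
      label G π (combine j (i ↑ˡ t)) + label G π (combine j (t ↑ʳ opposite i))
    ≡⟨ cong₂ _+_ (label-with (layerOrder-↑ˡ i) (toℕ-↑ˡ i t))
                 (label-with (layerOrder-↑ʳ (opposite i)) (toℕ-↑ʳ t (opposite i))) ⟩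
      suc (n * a + toℕ i) + suc (n * d + (t + toℕ (opposite i)))
    ≡⟨ complementary-sum a d (toℕ i) (toℕ (opposite i)) (suc-toℕ+toℕ-opposite i) ⟩
      suc (n * suc (a + d))
    ≡⟨ cong (λ r → suc (n * r)) (rankSum-parity j) ⟩
      suc (n * rankSum m (parity (toℕ j))) ∎
    where
    open ≡-Reasoning
    a d : ℕ
    a = toℕ (ascending ⟨$⟩ʳ j)
    d = toℕ (descending ⟨$⟩ʳ j)
    label-with : ∀ {h σ k} → layerOrder t h ≡ σ → toℕ h ≡ k →
                 label G π (combine j h) ≡ suc (n * toℕ (σ ⟨$⟩ʳ j) + k)
    label-with {h} σ≡ k≡ =
      trans (label-labelling j h) (cong₂ (λ σ k → suc (n * toℕ (σ ⟨$⟩ʳ j) + k)) σ≡ k≡)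

  layerSum-labelling : ∀ j → layerSum (Path m) n π j ≡ layerValue (parity (toℕ j))
  layerSum-labelling j = begin
      ∑[ h < t + t ] f h
    ≡⟨ ∑-↑ t f ⟩
      ∑[ i < t ] f (i ↑ˡ t) + ∑[ i < t ] f (t ↑ʳ i)
    ≡⟨ cong (∑[ i < t ] f (i ↑ˡ t) +_) (∑-permute (f ∘ (t ↑ʳ_)) reverse) ⟩
      ∑[ i < t ] f (i ↑ˡ t) + ∑[ i < t ] f (t ↑ʳ opposite i)
    ≡⟨ ∑-distrib-+ (f ∘ (_↑ˡ t)) (f ∘ (t ↑ʳ_) ∘ opposite) ⟨
      ∑[ i < t ] (f (i ↑ˡ t) + f (t ↑ʳ opposite i))
    ≡⟨ sum-cong-≗ (complementary-labels j) ⟩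
      ∑[ i < t ] suc (n * rankSum m (parity (toℕ j)))
    ≡⟨ ∑-const t _ ⟩
      layerValue (parity (toℕ j)) ∎
    where
    open ≡-Reasoning
    f : Fin n → ℕ
    f h = label G π (combine j h)

  weight-labelling : ∀ u → weight G π u ≡ neighbourSum m (layerValue ∘ parity) (toℕ (layer {m} n u))
  weight-labelling u = begin
      weight G π u
    ≡⟨ weight-Lex-Empty (Path m) n π u ⟩
      ∑[ k < m ] (if adj (Path m) (layer n u) k then layerSum (Path m) n π k else 0)
    ≡⟨ sum-cong-≗ (λ k → cong (if adj (Path m) (layer n u) k then_else 0) (layerSum-labelling k)) ⟩
      ∑[ k < m ] (if adj (Path m) (layer n u) k then layerValue (parity (toℕ k)) else 0)
    ≡⟨ ∑-adj-Path (layer {m} n u) (layerValue ∘ parity) ⟩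
      neighbourSum m (layerValue ∘ parity) (toℕ (layer {m} n u)) ∎
    where open ≡-Reasoning

OnceOrTwice : ℕ → ℕ → Set
OnceOrTwice c x = x ≡ c ⊎ x ≡ c + c

OnceOrTwice⇒≤double : ∀ {c x} → OnceOrTwice c x → x ≤ c + c
OnceOrTwice⇒≤double (inj₁ refl) = m≤m+n _ _
OnceOrTwice⇒≤double (inj₂ refl) = ≤-refl

OnceOrTwice⇒≥ : ∀ {c x} → OnceOrTwice c x → c ≤ x
OnceOrTwice⇒≥ (inj₁ refl) = ≤-refl
OnceOrTwice⇒≥ (inj₂ refl) = m≤m+n _ _

neighbourSum-parity : ∀ {m} (Λ : Parity → ℕ) j → 1 < m →
                      OnceOrTwice (Λ (parity (suc j))) (neighbourSum m (Λ ∘ parity) j)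
neighbourSum-parity {suc (suc m)} Λ zero    _        = inj₁ refl
neighbourSum-parity {suc zero}    Λ zero    (s≤s ())
neighbourSum-parity {m}           Λ (suc j) _ with suc (suc j) <ᵇ m
... | true  = inj₂ refl
... | false = inj₁ (+-identityʳ _)

odd-interior : ∀ {m j} → parity m ≡ 1ℙ → parity (suc j) ≡ 0ℙ → j < m → suc j < m
odd-interior pm pj j<m with m≤n⇒m<n∨m≡n j<m
... | inj₁ sj<m = sj<m
... | inj₂ refl with trans (sym pm) pj
...   | ()

neighbourSum-odd : ∀ {m} (Λ : Parity → ℕ) j → parity m ≡ 1ℙ → parity (suc j) ≡ 0ℙ → j < m →
                   neighbourSum m (Λ ∘ parity) j ≡ Λ 0ℙ + Λ 0ℙ
neighbourSum-odd     Λ zero    _  ()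
neighbourSum-odd {m} Λ (suc j) pm pj j<m with suc (suc j) <ᵇ m | <⇒<ᵇ (odd-interior pm pj j<m)
... | true  | _  = cong (λ p → Λ p + Λ p) pj
... | false | ()

double-suc : ∀ n o → suc (n * o) + suc (n * o) ≡ suc (n * (o + o) + 1)
double-suc = solve-∀

light-heavy : ∀ {n t} o e → 0 < t → 1 < n * e →
              t * suc (n * o) + t * suc (n * o) < t * suc (n * (o + o + e))
light-heavy {n} {t} o e 0<t 1<ne = begin-strict
    t * suc (n * o) + t * suc (n * o)  ≡⟨ *-distribˡ-+ t (suc (n * o)) (suc (n * o)) ⟨
    t * (suc (n * o) + suc (n * o))    <⟨ *-monoʳ-< t {{>-nonZero 0<t}} inner ⟩
    t * suc (n * (o + o + e))          ∎
  where
  open ≤-Reasoning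
  inner : suc (n * o) + suc (n * o) < suc (n * (o + o + e))
  inner = begin-strict
    suc (n * o) + suc (n * o)      ≡⟨ double-suc n o ⟩
    suc (n * (o + o) + 1)          <⟨ s≤s (+-monoʳ-< (n * (o + o)) 1<ne) ⟩
    suc (n * (o + o) + n * e)      ≡⟨ cong suc (*-distribˡ-+ n (o + o) e) ⟨
    suc (n * (o + o + e))          ∎

module _ (m t : ℕ) (1<m : 1 < m) (0<t : 0 < t) where

  private
    n : ℕ
    n = t + t
    G : Graph
    G = Lex (Path m) (Empty n)
    π : Permutation′ (m * n)
    π = labelling m t
    Λ : Parity → ℕ
    Λ = layerValue m t
    layerOf : Fin (m * n) → ℕ
    layerOf u = toℕ (layer {m} n u)

  weight-OnceOrTwice : ∀ u → OnceOrTwice (Λ (parity (suc (layerOf u)))) (weight G π u)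
  weight-OnceOrTwice u =
    subst (OnceOrTwice _) (sym (weight-labelling m t u)) (neighbourSum-parity Λ (layerOf u) 1<m)

  light<heavy : Λ 1ℙ + Λ 1ℙ < Λ 0ℙ
  light<heavy = light-heavy {n} ⌊ m /2⌋ ⌈ m /2⌉ 0<t
    (≤-trans (+-mono-≤ 0<t 0<t) (m≤m*n n ⌈ m /2⌉ {{>-nonZero (⌈n/2⌉-mono (<⇒≤ 1<m))}}))

  separated : ∀ p {x y} → OnceOrTwice (Λ p) x → OnceOrTwice (Λ (p ⁻¹)) y → x ≢ y
  separated 1ℙ x∈ y∈ =
    <⇒≢ (≤-<-trans (OnceOrTwice⇒≤double x∈) (<-≤-trans light<heavy (OnceOrTwice⇒≥ y∈)))
  separated 0ℙ x∈ y∈ =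
    >⇒≢ (≤-<-trans (OnceOrTwice⇒≤double y∈) (<-≤-trans light<heavy (OnceOrTwice⇒≥ x∈)))

  consecutive-layers : ∀ u v → suc (layerOf u) ≡ layerOf v → weight G π u ≢ weight G π v
  consecutive-layers u v e = separated (parity (suc (layerOf u))) (weight-OnceOrTwice u)
    (subst (λ p → OnceOrTwice (Λ p) (weight G π v)) next-parity (weight-OnceOrTwice v))
    where
    next-parity : parity (suc (layerOf v)) ≡ parity (suc (layerOf u)) ⁻¹
    next-parity = trans (cong (parity ∘ suc) (sym e)) (sym (suc-homo-⁻¹ (layerOf u)))

  labelling-LDA : IsLDA G π
  labelling-LDA u v uv = [ consecutive-layers u v , (λ e → consecutive-layers v u e ∘ sym) ]′
    (path-adjacent (layer n u) (layer n v) (trans (sym (adj-Lex-Empty (Path m) n u v)) uv))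

  OnceOrTwice-∈4 : ∀ p {x} → OnceOrTwice (Λ p) x → x ∈ (Λ 1ℙ ∷ Λ 1ℙ + Λ 1ℙ ∷ Λ 0ℙ ∷ Λ 0ℙ + Λ 0ℙ ∷ [])
  OnceOrTwice-∈4 1ℙ (inj₁ e) = here e
  OnceOrTwice-∈4 1ℙ (inj₂ e) = there (here e)
  OnceOrTwice-∈4 0ℙ (inj₁ e) = there (there (here e))
  OnceOrTwice-∈4 0ℙ (inj₂ e) = there (there (there (here e)))

  OnceOrTwice-∈3 : ∀ p {x} → (p ≡ 0ℙ → x ≡ Λ 0ℙ + Λ 0ℙ) → OnceOrTwice (Λ p) x →
                   x ∈ (Λ 1ℙ ∷ Λ 1ℙ + Λ 1ℙ ∷ Λ 0ℙ + Λ 0ℙ ∷ [])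
  OnceOrTwice-∈3 1ℙ _      (inj₁ e) = here e
  OnceOrTwice-∈3 1ℙ _      (inj₂ e) = there (here e)
  OnceOrTwice-∈3 0ℙ double _        = there (there (here (double refl)))

  χld≤4 : χld≤ G 4
  χld≤4 = π , labelling-LDA , _ , λ u → OnceOrTwice-∈4 (parity (suc (layerOf u))) (weight-OnceOrTwice u)

  χld≤3 : parity m ≡ 1ℙ → χld≤ G 3
  χld≤3 odd = π , labelling-LDA , _ , λ u →
    OnceOrTwice-∈3 (parity (suc (layerOf u))) (odd-layer u) (weight-OnceOrTwice u)
    where
    odd-layer : ∀ u → parity (suc (layerOf u)) ≡ 0ℙ → weight G π u ≡ Λ 0ℙ + Λ 0ℙ
    odd-layer u p = trans (weight-labelling m t u)
                          (neighbourSum-odd Λ (layerOf u) odd p (toℕ<n (layer {m} n u)))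

1<n+n⇒0<n : ∀ {n} → 1 < n + n → 0 < n
1<n+n⇒0<n {suc n} _ = s≤s z≤n

parity-odd : ∀ k → parity (suc (k + k)) ≡ 1ℙ
parity-odd k = trans (+-homo-+ 1 (k + k)) (cong (1ℙ ℙ.+_) (trans (+-homo-+ k k) (p+p≡0ℙ (parity k))))

mainTheorem12 : (m n : ℕ) → 1 < n → Even n → 3 ≤ m →
    (Odd m → χld≤ (Lex (Path m) (Empty n)) 3) × (Even m → χld≤ (Lex (Path m) (Empty n)) 4)
mainTheorem12 m .(t + t) 1<n (t , refl) 3≤m =
  (λ { (k , refl) → χld≤3 m t (<⇒≤ 3≤m) (1<n+n⇒0<n 1<n) (parity-odd k) }) ,
  (λ _ → χld≤4 m t (<⇒≤ 3≤m) (1<n+n⇒0<n 1<n))
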